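{- Let $(\varphi_j)_{j\ge0}$ be non-negative numbers with $\varphi_0>0$ and $\varphi(t)=\sum_j\varphi_jt^j$. Let $T_m$ be the total weight of free multilabelled increasing trees with label set $\{1,\dots,m\}$ and degree-weights $(\varphi_j)$, and let $\widetilde T_m$ be the total weight of (unilabelled) increasing trees with $m$ nodes and degree-weight generating function $\widetilde\varphi(t)=\varphi(t)+t$. Then $T_m=\widetilde T_m$ for all $m\ge1$.
   Context: All trees are ordered rooted trees (children linearly ordered); the weight of a tree with degree-weights $(\psi_j)$ is $\prod_{v}\psi_{\mathrm{outdeg}(v)}$, where $\mathrm{outdeg}(v)$ is the number of children. A free increasing multilabelling of a tree with label set $\{1,\dots,m\}$ assigns to each node a non-empty set of labels, these sets partitioning $\{1,\dots,m\}$, such that every label of a child is larger than every label of its parent; $T_m$ is the sum of weights (with weights $\varphi_j$) over all pairs (ordered tree, free increasing multilabelling with label set $\{1,\dots,m\}$). An increasing (unilabelled) tree with $m$ nodes is an ordered tree whose nodes carry distinct labels $1,\dots,m$ such that each child has a larger label than its parent; $\widetilde T_m$ is the sum of weights, with degree-weights $\widetilde\varphi_j=[t^j](\varphi(t)+t)$, over all such increasing trees with $m$ nodes.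
   Formalization: The degree-weights $(\varphi_j)$ are non-negative rationals with $\varphi_0>0$. -}

module Defs where

open import Data.Nat using (ℕ; zero; suc)
open import Data.Fin using (Fin; toℕ)
open import Data.Fin.Subset using (Subset; _∈_; Nonempty)
open import Data.Fin.Subset.Properties using (_∈?_)
open import Data.List using (List; []; _∷_; _++_; length; filter)
open import Data.List.Relation.Unary.All using (All)
open import Data.List.Relation.Unary.Unique.Propositional using (Unique)
open import Data.List.Membership.Propositional renaming (_∈_ to _∈ˡ_)
open import Data.Rational using (ℚ; 0ℚ; 1ℚ; _+_; _*_)
open import Relation.Binary.PropositionalEquality using (_≡_)

data LTree (A : Set) : Set where
  node : A → List (LTree A) → LTree A

root : ∀ {A} → LTree A → A
root (node a _) = a

mutual
  labels : ∀ {A} → LTree A → List A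
  labels (node a ts) = a ∷ labelsF ts

  labelsF : ∀ {A} → List (LTree A) → List A
  labelsF [] = []
  labelsF (t ∷ ts) = labels t ++ labelsF ts

mutual
  weight : ∀ {A} → (ℕ → ℚ) → LTree A → ℚ
  weight ψ (node _ ts) = ψ (length ts) * weightF ψ ts

  weightF : ∀ {A} → (ℕ → ℚ) → List (LTree A) → ℚ
  weightF ψ [] = 1ℚ
  weightF ψ (t ∷ ts) = weight ψ t * weightF ψ ts

data Increasing {A : Set} (R : A → A → Set) : LTree A → Set where
  inc : ∀ {a ts} → All (λ c → R a (root c)) ts → All (Increasing R) ts →
        Increasing R (node a ts)

-- Labels are 0,…,m-1 (standing for 1,…,m; the shift is order preserving).

FreeIncMultilabelled : (m : ℕ) → LTree (Subset m) → Set
FreeIncMultilabelled m t =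
  All Nonempty (labels t)
  × ((i : Fin m) → length (filter (i ∈?_) (labels t)) ≡ 1)
  × Increasing (λ S S′ → ∀ i j → i ∈ S → j ∈ S′ → toℕ i Data.Nat.< toℕ j) t
  where open import Data.Product using (_×_)
        import Data.Nat

IncreasingTree : (m : ℕ) → LTree (Fin m) → Set
IncreasingTree m t =
  ((i : Fin m) → length (filter (i Data.Fin.≟_) (labels t)) ≡ 1)
  × Increasing (λ a b → toℕ a Data.Nat.< toℕ b) t
  where open import Data.Product using (_×_)
        import Data.Nat
        import Data.Fin

record Enumerates {A : Set} (P : A → Set) (L : List A) : Set where
  field
    sound    : All P L
    complete : ∀ x → P x → x ∈ˡ L
    unique   : Unique L

totalWeight : ∀ {A} → (ℕ → ℚ) → List (LTree A) → ℚ
totalWeight ψ [] = 0ℚ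
totalWeight ψ (t ∷ ts) = weight ψ t + totalWeight ψ ts

tilde : (ℕ → ℚ) → ℕ → ℚ
tilde φ 1 = φ 1 + 1ℚ
tilde φ j = φ j

-- Expanding every node of a free multilabelled increasing tree, with label set
-- a₁ < ⋯ < aₖ, into the path a₁ – ⋯ – aₖ (its children hung below aₖ) yields an
-- increasing tree with the same label set.  Conversely, the multilabelled trees
-- expanding to an increasing tree t are obtained by deciding, for every node of t
-- with exactly one child, whether to merge it into that child.  Such a node
-- contributes the factor φ₁ if it is kept and 1 if it is merged away, so the fibre
-- of t has total weight ∏ᵥ φ̃_{outdeg v} with φ̃₁ = φ₁ + 1, and the fibres partition
-- the multilabelled trees.
module Submission where

open import Defs
open import Algebra.Bundles using (CommutativeMonoid)
open import Data.Bool.Base using (true; false)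
open import Data.Empty using (⊥-elim)
open import Data.Fin as Fin using (Fin; zero; suc; _≟_)
open import Data.Fin.Properties using (<-trans; <-irrefl)
open import Data.Fin.Subset using (Subset; inside; outside; _∈_; _∉_; ⊥; ⁅_⁆; _∪_; Nonempty)
open import Data.Fin.Subset.Properties
  using (_∈?_; x∈⁅x⁆; x∈⁅y⁆⇒x≡y; x∈p∪q⁺; x∈p∪q⁻; ∪-identityˡ; ⊆-antisym)
open import Data.List
  using (List; []; _∷_; _++_; map; concatMap; foldr; length; filter; cartesianProductWith)
open import Data.List.Properties using (filter-++; length-++; ++-identityʳ; ∷-injective)
open import Data.List.Membership.Propositional using (lose) renaming (_∈_ to _∈ˡ_)
open import Data.List.Membership.Propositional.Properties
  using ( ∈-map⁺; ∈-map⁻; ∈-++⁺ˡ; ∈-++⁺ʳ; ∈-++⁻; ∈-concatMap⁺; ∈-concatMap⁻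
        ; ∈-cartesianProductWith⁺; ∈-cartesianProductWith⁻)
open import Data.List.Membership.Propositional.Properties.WithK using (unique∧set⇒bag)
open import Data.List.Relation.Binary.BagAndSetEquality using (∼bag⇒↭)
open import Data.List.Relation.Binary.Disjoint.Propositional using (Disjoint)
open import Data.List.Relation.Binary.Permutation.Propositional as ↭ using (_↭_)
open import Data.List.Relation.Binary.Pointwise using (Pointwise; []; _∷_; Pointwise-length)
open import Data.List.Relation.Unary.All as All using (All; []; _∷_)
import Data.List.Relation.Unary.All.Properties as All
open import Data.List.Relation.Unary.AllPairs as AllPairs using (AllPairs; []; _∷_)
import Data.List.Relation.Unary.AllPairs.Properties as AllPairs
open import Data.List.Relation.Unary.Any using (here; there)
open import Data.List.Relation.Unary.Linked using (Linked; _∷_)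
open import Data.List.Relation.Unary.Linked.Properties using (AllPairs⇒Linked)
open import Data.List.Relation.Unary.Unique.Propositional using (Unique)
open import Data.List.Relation.Unary.Unique.Propositional.Properties
  using (++⁺; map⁺; cartesianProductWith⁺)
open import Data.Nat as ℕ using (ℕ; zero; suc; _≥_; z≤n; s≤s; s<s⁻¹)
open import Data.Product using (_,_; _×_; proj₁; proj₂)
open import Data.Rational using (ℚ; 0ℚ; 1ℚ; _+_; _*_; _≤_; _<_)
open import Data.Rational.Properties
  using ( +-identityˡ; +-identityʳ; +-assoc; *-identityˡ; *-identityʳ; *-zeroˡ; *-zeroʳ
        ; *-distribˡ-+; *-distribʳ-+; +-0-commutativeMonoid)
open import Algebra.Properties.CommutativeSemigroup
  (CommutativeMonoid.commutativeSemigroup +-0-commutativeMonoid) using (x∙yz≈y∙xz)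
open import Data.Sum using (inj₁; inj₂)
open import Data.Vec.Base using ([]; _∷_; here; there)
open import Function using (_∘_)
open import Function.Bundles using (mk⇔)
open import Relation.Binary.PropositionalEquality as ≡
  using (_≡_; _≢_; refl; trans; cong; cong₂; sym; subst; module ≡-Reasoning)
open import Relation.Nullary using (does; contradiction)
open import Relation.Unary using (Decidable)

module _ {A : Set} {xs ys : List A} where

  unique-sameMembers⇒↭ : Unique xs → Unique ys →
    (∀ {z} → z ∈ˡ xs → z ∈ˡ ys) → (∀ {z} → z ∈ˡ ys → z ∈ˡ xs) → xs ↭ ys
  unique-sameMembers⇒↭ xs! ys! xs⊆ys ys⊆xs =
    ∼bag⇒↭ (unique∧set⇒bag xs! ys! (mk⇔ xs⊆ys ys⊆xs))

  enumerations-↭ : ∀ {P : A → Set} → Enumerates P xs → Enumerates P ys → xs ↭ ys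
  enumerations-↭ exs eys = unique-sameMembers⇒↭ (unique exs) (unique eys)
      (λ z∈xs → complete eys _ (All.lookup (sound exs) z∈xs))
      (λ z∈ys → complete exs _ (All.lookup (sound eys) z∈ys))
    where open Enumerates

module _ {A B : Set} {P : A → Set} where

  map⁺-injectiveOn : ∀ {f : A → B} {xs} → (∀ {x y} → P x → P y → f x ≡ f y → x ≡ y) →
    All P xs → Unique xs → Unique (map f xs)
  map⁺-injectiveOn inj [] [] = []
  map⁺-injectiveOn inj (px ∷ pxs) (x∉xs ∷ xs!) =
    All.map⁺ (All.zipWith (λ (py , x≢y) fx≡fy → x≢y (inj px py fx≡fy)) (pxs , x∉xs))
    ∷ map⁺-injectiveOn inj pxs xs!

  concatMap⁺-fibres : ∀ (f : A → List B) (g : B → A) {xs} → (∀ {x} → P x → Unique (f x)) →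
    (∀ {x z} → P x → z ∈ˡ f x → g z ≡ x) → All P xs → Unique xs → Unique (concatMap f xs)
  concatMap⁺-fibres f g f! g-fibre [] [] = []
  concatMap⁺-fibres f g f! g-fibre (px ∷ pxs) (x∉xs ∷ xs!) =
    ++⁺ (f! px) (concatMap⁺-fibres f g f! g-fibre pxs xs!) λ (z∈fx , z∈rest) →
      All.lookupWith (λ (py , x≢y) z∈fy → x≢y (trans (sym (g-fibre px z∈fx)) (g-fibre py z∈fy)))
        (All.zip (pxs , x∉xs)) (∈-concatMap⁻ f z∈rest)

module _ (ψ : ℕ → ℚ) {A : Set} where

  totalWeightF : List (List (LTree A)) → ℚ
  totalWeightF []         = 0ℚ
  totalWeightF (cs ∷ css) = weightF ψ cs + totalWeightF css

  totalWeight-++ : ∀ (xs ys : List (LTree A)) →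
    totalWeight ψ (xs ++ ys) ≡ totalWeight ψ xs + totalWeight ψ ys
  totalWeight-++ []       ys = sym (+-identityˡ _)
  totalWeight-++ (x ∷ xs) ys = trans (cong (weight ψ x +_) (totalWeight-++ xs ys))
    (sym (+-assoc (weight ψ x) (totalWeight ψ xs) (totalWeight ψ ys)))

  totalWeightF-++ : ∀ (xss yss : List (List (LTree A))) →
    totalWeightF (xss ++ yss) ≡ totalWeightF xss + totalWeightF yss
  totalWeightF-++ []         yss = sym (+-identityˡ _)
  totalWeightF-++ (xs ∷ xss) yss = trans (cong (weightF ψ xs +_) (totalWeightF-++ xss yss))
    (sym (+-assoc (weightF ψ xs) (totalWeightF xss) (totalWeightF yss)))

  totalWeight-↭ : ∀ {xs ys : List (LTree A)} → xs ↭ ys → totalWeight ψ xs ≡ totalWeight ψ ys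
  totalWeight-↭ ↭.refl         = refl
  totalWeight-↭ (↭.prep x p)   = cong (weight ψ x +_) (totalWeight-↭ p)
  totalWeight-↭ (↭.swap x y p) = trans (x∙yz≈y∙xz (weight ψ x) (weight ψ y) _)
                                  (cong (λ s → weight ψ y + (weight ψ x + s)) (totalWeight-↭ p))
  totalWeight-↭ (↭.trans p q)  = trans (totalWeight-↭ p) (totalWeight-↭ q)

  totalWeight-map : ∀ {B : Set} (f : LTree B → LTree A) → (∀ t → weight ψ (f t) ≡ weight ψ t) → ∀ ts →
    totalWeight ψ (map f ts) ≡ totalWeight ψ ts
  totalWeight-map f wf []       = refl
  totalWeight-map f wf (t ∷ ts) = cong₂ _+_ (wf t) (totalWeight-map f wf ts)

  totalWeight-map-node : ∀ a {k} css → All (λ cs → length cs ≡ k) css →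
    totalWeight ψ (map (node a) css) ≡ ψ k * totalWeightF css
  totalWeight-map-node a {k} []         []            = sym (*-zeroʳ (ψ k))
  totalWeight-map-node a {k} (cs ∷ css) (refl ∷ ls) =
    trans (cong (ψ k * weightF ψ cs +_) (totalWeight-map-node a css ls))
      (sym (*-distribˡ-+ (ψ k) (weightF ψ cs) (totalWeightF css)))

  totalWeightF-map-∷ : ∀ t css → totalWeightF (map (t ∷_) css) ≡ weight ψ t * totalWeightF css
  totalWeightF-map-∷ t []         = sym (*-zeroʳ (weight ψ t))
  totalWeightF-map-∷ t (cs ∷ css) =
    trans (cong (weight ψ t * weightF ψ cs +_) (totalWeightF-map-∷ t css))
      (sym (*-distribˡ-+ (weight ψ t) (weightF ψ cs) (totalWeightF css)))

  totalWeightF-cartesianProduct : ∀ ts css →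
    totalWeightF (cartesianProductWith _∷_ ts css) ≡ totalWeight ψ ts * totalWeightF css
  totalWeightF-cartesianProduct []       css = sym (*-zeroˡ (totalWeightF css))
  totalWeightF-cartesianProduct (t ∷ ts) css = begin
    totalWeightF (map (t ∷_) css ++ cartesianProductWith _∷_ ts css)
      ≡⟨ totalWeightF-++ (map (t ∷_) css) _ ⟩
    totalWeightF (map (t ∷_) css) + totalWeightF (cartesianProductWith _∷_ ts css)
      ≡⟨ cong₂ _+_ (totalWeightF-map-∷ t css) (totalWeightF-cartesianProduct ts css) ⟩
    weight ψ t * totalWeightF css + totalWeight ψ ts * totalWeightF css
      ≡⟨ *-distribʳ-+ (totalWeightF css) (weight ψ t) (totalWeight ψ ts) ⟨
    (weight ψ t + totalWeight ψ ts) * totalWeightF css ∎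
    where open ≡-Reasoning

totalWeight-concatMap : ∀ {A B : Set} (ψ χ : ℕ → ℚ) (f : LTree B → List (LTree A)) →
  (∀ t → totalWeight ψ (f t) ≡ weight χ t) → ∀ ts →
  totalWeight ψ (concatMap f ts) ≡ totalWeight χ ts
totalWeight-concatMap ψ χ f wf []       = refl
totalWeight-concatMap ψ χ f wf (t ∷ ts) =
  trans (totalWeight-++ ψ (f t) _) (cong₂ _+_ (wf t) (totalWeight-concatMap ψ χ f wf ts))

length-filter-++ : ∀ {A : Set} {P : A → Set} (P? : Decidable P) xs ys →
  length (filter P? (xs ++ ys)) ≡ length (filter P? xs) ℕ.+ length (filter P? ys)
length-filter-++ P? xs ys = trans (cong length (filter-++ P? xs ys)) (length-++ (filter P? xs))

count : ∀ {n} → Fin n → List (Fin n) → ℕ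
count i xs = length (filter (i ≟_) xs)

countˢ : ∀ {n} → Fin n → List (Subset n) → ℕ
countˢ i ps = length (filter (i ∈?_) ps)

elements : ∀ {n} → Subset n → List (Fin n)
elements []            = []
elements (inside ∷ p)  = zero ∷ map suc (elements p)
elements (outside ∷ p) = map suc (elements p)

∈-elements⁺ : ∀ {n} {x : Fin n} {p} → x ∈ p → x ∈ˡ elements p
∈-elements⁺ here = here refl
∈-elements⁺ {p = inside ∷ _}  (there x∈p) = there (∈-map⁺ suc (∈-elements⁺ x∈p))
∈-elements⁺ {p = outside ∷ _} (there x∈p) = ∈-map⁺ suc (∈-elements⁺ x∈p)

∈-elements⁻ : ∀ {n} {x : Fin n} p → x ∈ˡ elements p → x ∈ p
∈-elements⁻ (inside ∷ p) (here refl) = here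
∈-elements⁻ (inside ∷ p) (there x∈)
  with _ , y∈ , refl ← ∈-map⁻ suc x∈ = there (∈-elements⁻ p y∈)
∈-elements⁻ (outside ∷ p) x∈
  with _ , y∈ , refl ← ∈-map⁻ suc x∈ = there (∈-elements⁻ p y∈)

elements≢[] : ∀ {n} {p : Subset n} → Nonempty p → elements p ≢ []
elements≢[] (x , x∈p) eq with () ← subst (x ∈ˡ_) eq (∈-elements⁺ x∈p)

elements-increasing : ∀ {n} (p : Subset n) → AllPairs Fin._<_ (elements p)
elements-increasing []            = []
elements-increasing (inside ∷ p)  =
  All.map⁺ (All.universal (λ _ → s≤s z≤n) (elements p))
  ∷ AllPairs.map⁺ (AllPairs.map s≤s (elements-increasing p))
elements-increasing (outside ∷ p) = AllPairs.map⁺ (AllPairs.map s≤s (elements-increasing p))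

count-zero-map-suc : ∀ {n} (xs : List (Fin n)) → count zero (map suc xs) ≡ 0
count-zero-map-suc []       = refl
count-zero-map-suc (_ ∷ xs) = count-zero-map-suc xs

count-suc-map-suc : ∀ {n} (i : Fin n) xs → count (suc i) (map suc xs) ≡ count i xs
count-suc-map-suc i []       = refl
count-suc-map-suc i (x ∷ xs) with does (i ≟ x)
... | true  = cong suc (count-suc-map-suc i xs)
... | false = count-suc-map-suc i xs

count-elements : ∀ {n} (i : Fin n) p → count i (elements p) ≡ countˢ i (p ∷ [])
count-elements zero    (inside ∷ p)  = cong suc (count-zero-map-suc (elements p))
count-elements zero    (outside ∷ p) = count-zero-map-suc (elements p)
count-elements (suc i) (s ∷ p) = begin
  count (suc i) (elements (s ∷ p))    ≡⟨ count-suc-elements s ⟩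
  count (suc i) (map suc (elements p)) ≡⟨ count-suc-map-suc i (elements p) ⟩
  count i (elements p)                 ≡⟨ count-elements i p ⟩
  countˢ i (p ∷ [])                    ≡⟨ countˢ-suc s ⟩
  countˢ (suc i) ((s ∷ p) ∷ [])        ∎
  where
  open ≡-Reasoning
  count-suc-elements : ∀ s → count (suc i) (elements (s ∷ p)) ≡ count (suc i) (map suc (elements p))
  count-suc-elements inside  = refl
  count-suc-elements outside = refl
  countˢ-suc : ∀ s → countˢ i (p ∷ []) ≡ countˢ (suc i) ((s ∷ p) ∷ [])
  countˢ-suc s with does (i ∈? p)
  ... | true  = refl
  ... | false = refl

elements-⊥ : ∀ {n} → elements (⊥ {n}) ≡ []
elements-⊥ {zero}  = refl
elements-⊥ {suc n} = cong (map suc) (elements-⊥ {n})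

elements-⁅⁆ : ∀ {n} (a : Fin n) → elements ⁅ a ⁆ ≡ a ∷ []
elements-⁅⁆ zero    = cong (λ xs → zero ∷ map suc xs) elements-⊥
elements-⁅⁆ (suc a) = cong (map suc) (elements-⁅⁆ a)

elements-⁅⁆∪ : ∀ {n} (a : Fin n) p → (∀ {j} → j ∈ p → a Fin.< j) →
  elements (⁅ a ⁆ ∪ p) ≡ a ∷ elements p
elements-⁅⁆∪ zero    (inside ∷ p)  a<p with () ← a<p here
elements-⁅⁆∪ zero    (outside ∷ p) a<p = cong (λ q → zero ∷ map suc (elements q)) (∪-identityˡ p)
elements-⁅⁆∪ (suc a) (inside ∷ p)  a<p with () ← a<p here
elements-⁅⁆∪ (suc a) (outside ∷ p) a<p =
  cong (map suc) (elements-⁅⁆∪ a p (λ j∈p → s<s⁻¹ (a<p (there j∈p))))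

fromList⁺ : ∀ {n} → Fin n → List (Fin n) → Subset n
fromList⁺ a []      = ⁅ a ⁆
fromList⁺ a (b ∷ l) = ⁅ a ⁆ ∪ fromList⁺ b l

∈-fromList⁺⁻ : ∀ {n} {x : Fin n} a l → x ∈ fromList⁺ a l → x ∈ˡ a ∷ l
∈-fromList⁺⁻ a []      x∈ = here (x∈⁅y⁆⇒x≡y a x∈)
∈-fromList⁺⁻ a (b ∷ l) x∈ with x∈p∪q⁻ ⁅ a ⁆ (fromList⁺ b l) x∈
... | inj₁ x∈a = here (x∈⁅y⁆⇒x≡y a x∈a)
... | inj₂ x∈l = there (∈-fromList⁺⁻ b l x∈l)

∈-fromList⁺⁺ : ∀ {n} {x : Fin n} a l → x ∈ˡ a ∷ l → x ∈ fromList⁺ a l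
∈-fromList⁺⁺ a []      (here refl) = x∈⁅x⁆ a
∈-fromList⁺⁺ a (b ∷ l) (here refl) = x∈p∪q⁺ (inj₁ (x∈⁅x⁆ a))
∈-fromList⁺⁺ a (b ∷ l) (there x∈)  = x∈p∪q⁺ (inj₂ (∈-fromList⁺⁺ b l x∈))

fromList⁺-elements : ∀ {n} {a : Fin n} {l} p → elements p ≡ a ∷ l → fromList⁺ a l ≡ p
fromList⁺-elements {a = a} {l} p eq = ⊆-antisym
  (λ x∈ → ∈-elements⁻ p (subst (_ ∈ˡ_) (sym eq) (∈-fromList⁺⁻ a l x∈)))
  (λ x∈ → ∈-fromList⁺⁺ a l (subst (_ ∈ˡ_) eq (∈-elements⁺ x∈)))

⁅⁆∪-injective : ∀ {n} {a : Fin n} {p q} → a ∉ p → a ∉ q → ⁅ a ⁆ ∪ p ≡ ⁅ a ⁆ ∪ q → p ≡ q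
⁅⁆∪-injective {a = a} a∉p a∉q eq = ⊆-antisym (⊆-cancel a∉p eq) (⊆-cancel a∉q (sym eq))
  where
  ⊆-cancel : ∀ {r s} → a ∉ r → ⁅ a ⁆ ∪ r ≡ ⁅ a ⁆ ∪ s → ∀ {x} → x ∈ r → x ∈ s
  ⊆-cancel {s = s} a∉r eq {x} x∈r with x∈p∪q⁻ ⁅ a ⁆ s (subst (x ∈_) eq (x∈p∪q⁺ (inj₂ x∈r)))
  ... | inj₁ x∈a with refl ← x∈⁅y⁆⇒x≡y a x∈a = ⊥-elim (a∉r x∈r)
  ... | inj₂ x∈s = x∈s

-- Contractions of an increasing tree

module _ {m : ℕ} where

  _≺_ : Subset m → Subset m → Set
  A ≺ B = ∀ i j → i ∈ A → j ∈ B → i Fin.< j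

  mergeRoot : Fin m → LTree (Subset m) → LTree (Subset m)
  mergeRoot a (node A cs) = node (⁅ a ⁆ ∪ A) cs

  -- c ◁ t: the multilabelled tree c arises from t by merging some nodes of t
  -- with their only child (the merged node carries the union of the labels).
  data _◁_ : LTree (Subset m) → LTree (Fin m) → Set where
    keep  : ∀ {a cs ts} → Pointwise _◁_ cs ts → node ⁅ a ⁆ cs ◁ node a ts
    merge : ∀ {a c t} → c ◁ t → mergeRoot a c ◁ node a (t ∷ [])

  mutual
    fibre : LTree (Fin m) → List (LTree (Subset m))
    fibre (node a ts) = map (node ⁅ a ⁆) (choices ts) ++ merges a ts

    merges : Fin m → List (LTree (Fin m)) → List (LTree (Subset m))
    merges a []           = []
    merges a (t ∷ [])     = map (mergeRoot a) (fibre t)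
    merges a (_ ∷ _ ∷ _)  = []

    choices : List (LTree (Fin m)) → List (List (LTree (Subset m)))
    choices []       = [] ∷ []
    choices (t ∷ ts) = cartesianProductWith _∷_ (fibre t) (choices ts)

  mutual
    fibre-sound : ∀ t {c} → c ∈ˡ fibre t → c ◁ t
    fibre-sound (node a ts) c∈ with ∈-++⁻ (map (node ⁅ a ⁆) (choices ts)) c∈
    ... | inj₁ c∈keeps
      with _ , cs∈ , refl ← ∈-map⁻ (node ⁅ a ⁆) c∈keeps = keep (choices-sound ts cs∈)
    ... | inj₂ c∈merges = merges-sound ts c∈merges

    merges-sound : ∀ {a} ts {c} → c ∈ˡ merges a ts → c ◁ node a ts
    merges-sound {a} (t ∷ []) c∈
      with _ , c∈ , refl ← ∈-map⁻ (mergeRoot a) c∈ = merge (fibre-sound t c∈)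

    choices-sound : ∀ ts {cs} → cs ∈ˡ choices ts → Pointwise _◁_ cs ts
    choices-sound []       (here refl) = []
    choices-sound (t ∷ ts) cs∈
      with _ , _ , c∈ , cs∈ , refl ← ∈-cartesianProductWith⁻ _∷_ (fibre t) (choices ts) cs∈
      = fibre-sound t c∈ ∷ choices-sound ts cs∈

  mutual
    fibre-complete : ∀ {c t} → c ◁ t → c ∈ˡ fibre t
    fibre-complete (keep cs◁ts) = ∈-++⁺ˡ (∈-map⁺ _ (choices-complete cs◁ts))
    fibre-complete (merge {a} {t = t} c◁t) =
      ∈-++⁺ʳ (map (node ⁅ a ⁆) (choices (t ∷ []))) (∈-map⁺ (mergeRoot a) (fibre-complete c◁t))

    choices-complete : ∀ {cs ts} → Pointwise _◁_ cs ts → cs ∈ˡ choices ts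
    choices-complete []              = here refl
    choices-complete (c◁t ∷ cs◁ts) =
      ∈-cartesianProductWith⁺ _∷_ (fibre-complete c◁t) (choices-complete cs◁ts)

  ◁-root∈ : ∀ {c t} → c ◁ t → root t ∈ root c
  ◁-root∈ (keep {a} _)                 = x∈⁅x⁆ a
  ◁-root∈ (merge {a} {c = node _ _} _) = x∈p∪q⁺ (inj₁ (x∈⁅x⁆ a))

  ◁-root-above : ∀ {a c t} → Increasing Fin._<_ t → c ◁ t → a Fin.< root t →
    ∀ {j} → j ∈ root c → a Fin.< j
  ◁-root-above _ (keep {b} _) a<b j∈ with refl ← x∈⁅y⁆⇒x≡y b j∈ = a<b
  ◁-root-above (inc (b<t ∷ []) (t↑ ∷ [])) (merge {b} {c = node B _} c◁t) a<b j∈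
    with x∈p∪q⁻ ⁅ b ⁆ B j∈
  ... | inj₁ j∈b with refl ← x∈⁅y⁆⇒x≡y b j∈b = a<b
  ... | inj₂ j∈B = ◁-root-above t↑ c◁t (<-trans a<b b<t) j∈B

  mutual
    ◁-nonempty : ∀ {c t} → c ◁ t → All Nonempty (labels c)
    ◁-nonempty (keep {a} cs◁ts) = (a , x∈⁅x⁆ a) ∷ ◁*-nonempty cs◁ts
    ◁-nonempty (merge {a} {c = node _ _} c◁t) with _ ∷ ne ← ◁-nonempty c◁t =
      (a , x∈p∪q⁺ (inj₁ (x∈⁅x⁆ a))) ∷ ne

    ◁*-nonempty : ∀ {cs ts} → Pointwise _◁_ cs ts → All Nonempty (labelsF cs)
    ◁*-nonempty []              = []
    ◁*-nonempty (c◁t ∷ cs◁ts) = All.++⁺ (◁-nonempty c◁t) (◁*-nonempty cs◁ts)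

  ◁*-above : ∀ {a cs ts} → All (λ t → a Fin.< root t) ts → All (Increasing Fin._<_) ts →
    Pointwise _◁_ cs ts → All (λ c → ⁅ a ⁆ ≺ root c) cs
  ◁*-above []            []          []              = []
  ◁*-above {a} (a<t ∷ a<ts) (t↑ ∷ ts↑) (c◁t ∷ cs◁ts) =
    (λ i j i∈a j∈c → subst (Fin._< j) (sym (x∈⁅y⁆⇒x≡y a i∈a)) (◁-root-above t↑ c◁t a<t j∈c))
    ∷ ◁*-above a<ts ts↑ cs◁ts

  mutual
    ◁-increasing : ∀ {c t} → Increasing Fin._<_ t → c ◁ t → Increasing _≺_ c
    ◁-increasing (inc a<ts ts↑) (keep cs◁ts) =
      inc (◁*-above a<ts ts↑ cs◁ts) (◁*-increasing ts↑ cs◁ts)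
    ◁-increasing (inc (a<t ∷ []) (t↑ ∷ [])) (merge {a} {c = node A _} c◁t)
      with inc A≺cs cs↑ ← ◁-increasing t↑ c◁t = inc (All.map extend A≺cs) cs↑
      where
      extend : ∀ {B} → A ≺ B → (⁅ a ⁆ ∪ A) ≺ B
      extend A≺B i j i∈ j∈B with x∈p∪q⁻ ⁅ a ⁆ A i∈
      ... | inj₁ i∈a with refl ← x∈⁅y⁆⇒x≡y a i∈a = <-trans a<t (A≺B _ j (◁-root∈ c◁t) j∈B)
      ... | inj₂ i∈A = A≺B i j i∈A j∈B

    ◁*-increasing : ∀ {cs ts} → All (Increasing Fin._<_) ts → Pointwise _◁_ cs ts →
      All (Increasing _≺_) cs
    ◁*-increasing []          []              = []
    ◁*-increasing (t↑ ∷ ts↑) (c◁t ∷ cs◁ts) = ◁-increasing t↑ c◁t ∷ ◁*-increasing ts↑ cs◁ts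

  node-injective : ∀ {A : Set} {a b : A} {xs ys} → node a xs ≡ node b ys → a ≡ b × xs ≡ ys
  node-injective refl = refl , refl

  mergeRoot-injective : ∀ {a c d} → a ∉ root c → a ∉ root d → mergeRoot a c ≡ mergeRoot a d → c ≡ d
  mergeRoot-injective {c = node _ cs} {node _ _} a∉c a∉d eq with A≡B , refl ← node-injective eq =
    cong (λ A → node A cs) (⁅⁆∪-injective a∉c a∉d A≡B)

  ◁-root∌ : ∀ {a c t} → Increasing Fin._<_ t → c ◁ t → a Fin.< root t → a ∉ root c
  ◁-root∌ t↑ c◁t a<t a∈c = <-irrefl refl (◁-root-above t↑ c◁t a<t a∈c)

  keeps-merges-disjoint : ∀ {a ts} → All (λ t → a Fin.< root t) ts →
    Disjoint (map (node ⁅ a ⁆) (choices ts)) (merges a ts)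
  keeps-merges-disjoint {ts = []}        _ (_ , ())
  keeps-merges-disjoint {ts = _ ∷ _ ∷ _} _ (_ , ())
  keeps-merges-disjoint {a} {t ∷ []} (a<t ∷ []) (z∈keeps , z∈merges)
    with _ , _ , refl ← ∈-map⁻ (node ⁅ a ⁆) z∈keeps
       | node _ _ , c∈ , eq ← ∈-map⁻ (mergeRoot a) z∈merges
    = <-irrefl (sym (x∈⁅y⁆⇒x≡y a t∈z)) a<t
    where
    t∈z : root t ∈ ⁅ a ⁆
    t∈z = subst (root t ∈_) (sym (cong root eq)) (x∈p∪q⁺ (inj₂ (◁-root∈ (fibre-sound t c∈))))

  mutual
    fibre-unique : ∀ {t} → Increasing Fin._<_ t → Unique (fibre t)
    fibre-unique (inc a<ts ts↑) =
      ++⁺ (map⁺ (λ eq → proj₂ (node-injective eq)) (choices-unique ts↑))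
          (merges-unique a<ts ts↑) (keeps-merges-disjoint a<ts)

    merges-unique : ∀ {a ts} → All (λ t → a Fin.< root t) ts → All (Increasing Fin._<_) ts →
      Unique (merges a ts)
    merges-unique []          []          = []
    merges-unique (a<t ∷ []) (t↑ ∷ []) =
      map⁺-injectiveOn mergeRoot-injective
        (All.tabulate (λ c∈ → ◁-root∌ t↑ (fibre-sound _ c∈) a<t)) (fibre-unique t↑)
    merges-unique (_ ∷ _ ∷ _) _ = []

    choices-unique : ∀ {ts} → All (Increasing Fin._<_) ts → Unique (choices ts)
    choices-unique []          = [] ∷ []
    choices-unique (t↑ ∷ ts↑) =
      cartesianProductWith⁺ _∷_ ∷-injective (fibre-unique t↑) (choices-unique ts↑)

  weight-mergeRoot : ∀ ψ a c → weight ψ (mergeRoot a c) ≡ weight ψ c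
  weight-mergeRoot ψ a (node _ _) = refl

  choices-length : ∀ ts {cs} → cs ∈ˡ choices ts → length cs ≡ length ts
  choices-length ts cs∈ = Pointwise-length (choices-sound ts cs∈)

  module _ (φ : ℕ → ℚ) where
    open ≡-Reasoning

    mutual
      fibre-weight : ∀ t → totalWeight φ (fibre t) ≡ weight (tilde φ) t
      fibre-weight (node a ts) = begin
        totalWeight φ (keeps ++ merges a ts)
          ≡⟨ totalWeight-++ φ keeps (merges a ts) ⟩
        totalWeight φ keeps + totalWeight φ (merges a ts)
          ≡⟨ cong (_+ totalWeight φ (merges a ts))
               (totalWeight-map-node φ ⁅ a ⁆ (choices ts) (All.tabulate (choices-length ts))) ⟩
        φ (length ts) * totalWeightF φ (choices ts) + totalWeight φ (merges a ts)
          ≡⟨ cong (λ w → φ (length ts) * w + totalWeight φ (merges a ts)) (choices-weight ts) ⟩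
        φ (length ts) * weightF (tilde φ) ts + totalWeight φ (merges a ts)
          ≡⟨ merges-weight a ts ⟩
        tilde φ (length ts) * weightF (tilde φ) ts ∎
        where keeps = map (node ⁅ a ⁆) (choices ts)

      merges-weight : ∀ a ts → φ (length ts) * weightF (tilde φ) ts + totalWeight φ (merges a ts)
                                 ≡ tilde φ (length ts) * weightF (tilde φ) ts
      merges-weight a []          = +-identityʳ _
      merges-weight a (t ∷ [])    = begin
        φ 1 * w + totalWeight φ (map (mergeRoot a) (fibre t))
          ≡⟨ cong (φ 1 * w +_) (trans (totalWeight-map φ (mergeRoot a) (weight-mergeRoot φ a) (fibre t))
                                      (fibre-weight t)) ⟩
        φ 1 * w + weight (tilde φ) t
          ≡⟨ cong (φ 1 * w +_) (trans (sym (*-identityʳ _)) (sym (*-identityˡ w))) ⟩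
        φ 1 * w + 1ℚ * w
          ≡⟨ *-distribʳ-+ w (φ 1) 1ℚ ⟨
        (φ 1 + 1ℚ) * w ∎
        where w = weight (tilde φ) t * 1ℚ
      merges-weight a (_ ∷ _ ∷ _) = +-identityʳ _

      choices-weight : ∀ ts → totalWeightF φ (choices ts) ≡ weightF (tilde φ) ts
      choices-weight []       = +-identityʳ 1ℚ
      choices-weight (t ∷ ts) = trans (totalWeightF-cartesianProduct φ (fibre t) (choices ts))
                                      (cong₂ _*_ (fibre-weight t) (choices-weight ts))

-- Expanding a multilabelled tree

module _ {m : ℕ} where

  -- path a (b₁ ∷ ⋯ ∷ bₖ) us is the path a – b₁ – ⋯ – bₖ with the forest us hung below bₖ.
  path : Fin m → List (Fin m) → List (LTree (Fin m)) → LTree (Fin m)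
  path a l us = node a (foldr (λ b vs → node b vs ∷ []) us l)

  labels-path : ∀ a l us → labels (path a l us) ≡ a ∷ l ++ labelsF us
  labels-path a []      us = refl
  labels-path a (b ∷ l) us = cong (a ∷_) (trans (++-identityʳ _) (labels-path b l us))

  path-◁ : ∀ a l {cs us} → Pointwise _◁_ cs us → node (fromList⁺ a l) cs ◁ path a l us
  path-◁ a []      cs◁us = keep cs◁us
  path-◁ a (b ∷ l) cs◁us = merge (path-◁ b l cs◁us)

  path-increasing : ∀ {a l us} → Linked Fin._<_ (a ∷ l) →
    (∀ {x} → x ∈ˡ a ∷ l → All (λ u → x Fin.< root u) us) → All (Increasing Fin._<_) us →
    Increasing Fin._<_ (path a l us)
  path-increasing {l = []}    _              l<us us↑ = inc (l<us (here refl)) us↑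
  path-increasing {l = _ ∷ _} (a<b ∷ b∷l↑) l<us us↑ =
    inc (a<b ∷ []) (path-increasing b∷l↑ (λ x∈ → l<us (there x∈)) us↑ ∷ [])

module _ {n : ℕ} where

  -- Nodes with an empty label set never occur in a multilabelled tree;
  -- they are sent to the junk label zero.
  expandNode : List (Fin (suc n)) → List (LTree (Fin (suc n))) → LTree (Fin (suc n))
  expandNode []      us = node zero us
  expandNode (a ∷ l) us = path a l us

  mutual
    expand : LTree (Subset (suc n)) → LTree (Fin (suc n))
    expand (node A cs) = expandNode (elements A) (expandF cs)

    expandF : List (LTree (Subset (suc n))) → List (LTree (Fin (suc n)))
    expandF []       = []
    expandF (c ∷ cs) = expand c ∷ expandF cs

  mutual
    ◁-expand : ∀ {c t} → Increasing Fin._<_ t → c ◁ t → expand c ≡ t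
    ◁-expand (inc _ ts↑) (keep {a} cs◁ts) rewrite elements-⁅⁆ a =
      cong (node a) (◁*-expandF ts↑ cs◁ts)
    ◁-expand (inc (a<t ∷ []) (t↑ ∷ [])) (merge {a} {node A cs} c◁t)
      rewrite elements-⁅⁆∪ a A (◁-root-above t↑ c◁t a<t)
      with elements A in eq | ◁-expand t↑ c◁t
    ... | []    | _    = contradiction eq (elements≢[] (_ , ◁-root∈ c◁t))
    ... | _ ∷ _ | refl = refl

    ◁*-expandF : ∀ {cs ts} → All (Increasing Fin._<_) ts → Pointwise _◁_ cs ts → expandF cs ≡ ts
    ◁*-expandF []          []              = refl
    ◁*-expandF (t↑ ∷ ts↑) (c◁t ∷ cs◁ts) = cong₂ _∷_ (◁-expand t↑ c◁t) (◁*-expandF ts↑ cs◁ts)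

  mutual
    expand-◁ : ∀ c → All Nonempty (labels c) → c ◁ expand c
    expand-◁ (node A cs) (A≠∅ ∷ cs≠∅) with elements A in eq
    ... | []    = contradiction eq (elements≢[] A≠∅)
    ... | a ∷ l = subst (λ B → node B cs ◁ path a l (expandF cs)) (fromList⁺-elements A eq)
                        (path-◁ a l (expandF-◁* cs cs≠∅))

    expandF-◁* : ∀ cs → All Nonempty (labelsF cs) → Pointwise _◁_ cs (expandF cs)
    expandF-◁* []       _  = []
    expandF-◁* (c ∷ cs) ne with c≠∅ , cs≠∅ ← All.++⁻ (labels c) ne = expand-◁ c c≠∅ ∷ expandF-◁* cs cs≠∅

  root-expand∈ : ∀ c → All Nonempty (labels c) → root (expand c) ∈ root c
  root-expand∈ (node A cs) (A≠∅ ∷ _) with elements A in eq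
  ... | []    = contradiction eq (elements≢[] A≠∅)
  ... | a ∷ l = ∈-elements⁻ A (subst (a ∈ˡ_) (sym eq) (here refl))

  expandF-above : ∀ {x A} → x ∈ A → ∀ cs → All Nonempty (labelsF cs) → All (λ c → A ≺ root c) cs →
    All (λ u → x Fin.< root u) (expandF cs)
  expandF-above x∈A []       _  []            = []
  expandF-above x∈A (c ∷ cs) ne (A≺c ∷ A≺cs) with c≠∅ , cs≠∅ ← All.++⁻ (labels c) ne =
    A≺c _ _ x∈A (root-expand∈ c c≠∅) ∷ expandF-above x∈A cs cs≠∅ A≺cs

  mutual
    expand-increasing : ∀ c → All Nonempty (labels c) → Increasing _≺_ c →
      Increasing Fin._<_ (expand c)
    expand-increasing (node A cs) (A≠∅ ∷ cs≠∅) (inc A≺cs cs↑)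
      with elements A in eq | elements-increasing A
    ... | []    | _    = contradiction eq (elements≢[] A≠∅)
    ... | a ∷ l | a∷l↑ = path-increasing (AllPairs⇒Linked a∷l↑)
        (λ x∈ → expandF-above (∈-elements⁻ A (subst (_ ∈ˡ_) (sym eq) x∈)) cs cs≠∅ A≺cs)
        (expandF-increasing cs cs≠∅ cs↑)

    expandF-increasing : ∀ cs → All Nonempty (labelsF cs) → All (Increasing _≺_) cs →
      All (Increasing Fin._<_) (expandF cs)
    expandF-increasing []       _  []          = []
    expandF-increasing (c ∷ cs) ne (c↑ ∷ cs↑) with c≠∅ , cs≠∅ ← All.++⁻ (labels c) ne =
      expand-increasing c c≠∅ c↑ ∷ expandF-increasing cs cs≠∅ cs↑

  mutual
    count-expand : ∀ i c → All Nonempty (labels c) →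
      count i (labels (expand c)) ≡ countˢ i (labels c)
    count-expand i (node A cs) (A≠∅ ∷ cs≠∅) with elements A in eq | count-elements i A
    ... | []    | _  = contradiction eq (elements≢[] A≠∅)
    ... | a ∷ l | #A = begin
      count i (labels (path a l (expandF cs)))
        ≡⟨ cong (count i) (labels-path a l (expandF cs)) ⟩
      count i (a ∷ l ++ labelsF (expandF cs))
        ≡⟨ length-filter-++ (i ≟_) (a ∷ l) _ ⟩
      count i (a ∷ l) ℕ.+ count i (labelsF (expandF cs))
        ≡⟨ cong₂ ℕ._+_ #A (count-expandF i cs cs≠∅) ⟩
      countˢ i (A ∷ []) ℕ.+ countˢ i (labelsF cs)
        ≡⟨ length-filter-++ (i ∈?_) (A ∷ []) (labelsF cs) ⟨
      countˢ i (A ∷ labelsF cs) ∎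
      where open ≡-Reasoning

    count-expandF : ∀ i cs → All Nonempty (labelsF cs) →
      count i (labelsF (expandF cs)) ≡ countˢ i (labelsF cs)
    count-expandF i []       _  = refl
    count-expandF i (c ∷ cs) ne with c≠∅ , cs≠∅ ← All.++⁻ (labels c) ne = begin
      count i (labels (expand c) ++ labelsF (expandF cs))
        ≡⟨ length-filter-++ (i ≟_) (labels (expand c)) _ ⟩
      count i (labels (expand c)) ℕ.+ count i (labelsF (expandF cs))
        ≡⟨ cong₂ ℕ._+_ (count-expand i c c≠∅) (count-expandF i cs cs≠∅) ⟩
      countˢ i (labels c) ℕ.+ countˢ i (labelsF cs)
        ≡⟨ length-filter-++ (i ∈?_) (labels c) (labelsF cs) ⟨
      countˢ i (labels c ++ labelsF cs) ∎
      where open ≡-Reasoning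

  fibre-freeIncMultilabelled : ∀ {t c} → IncreasingTree (suc n) t → c ∈ˡ fibre t →
    FreeIncMultilabelled (suc n) c
  fibre-freeIncMultilabelled {t} {c} (#t , t↑) c∈ = c≠∅ , #c , ◁-increasing t↑ c◁t
    where
    c◁t = fibre-sound t c∈
    c≠∅ = ◁-nonempty c◁t
    #c : ∀ i → countˢ i (labels c) ≡ 1
    #c i = begin
      countˢ i (labels c)          ≡⟨ count-expand i c c≠∅ ⟨
      count i (labels (expand c))  ≡⟨ cong (count i ∘ labels) (◁-expand t↑ c◁t) ⟩
      count i (labels t)           ≡⟨ #t i ⟩
      1                            ∎
      where open ≡-Reasoning

  expand-increasingTree : ∀ {c} → FreeIncMultilabelled (suc n) c → IncreasingTree (suc n) (expand c)
  expand-increasingTree {c} (c≠∅ , #c , c↑) =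
    (λ i → trans (count-expand i c c≠∅) (#c i)) , expand-increasing c c≠∅ c↑

  fibres-enumerate : ∀ {ts} → Enumerates (IncreasingTree (suc n)) ts →
    Enumerates (FreeIncMultilabelled (suc n)) (concatMap fibre ts)
  fibres-enumerate e = record
    { sound    = All.tabulate λ c∈ →
        All.lookupWith fibre-freeIncMultilabelled (sound e) (∈-concatMap⁻ fibre c∈)
    ; complete = λ c c-multi → ∈-concatMap⁺ fibre (lose (complete e _ (expand-increasingTree c-multi))
                                                  (fibre-complete (expand-◁ c (proj₁ c-multi))))
    ; unique   = concatMap⁺-fibres fibre expand (λ (_ , t↑) → fibre-unique t↑)
                   (λ (_ , t↑) c∈ → ◁-expand t↑ (fibre-sound _ c∈)) (sound e) (unique e)
    }
    where open Enumerates

corollary7p2 : (φ : ℕ → ℚ) → (∀ j → 0ℚ ≤ φ j) → 0ℚ < φ 0 →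
    (m : ℕ) → m ≥ 1 →
    (L : List (LTree (Subset m))) → Enumerates (FreeIncMultilabelled m) L →
    (L′ : List (LTree (Fin m))) → Enumerates (IncreasingTree m) L′ →
    totalWeight φ L ≡ totalWeight (tilde φ) L′
corollary7p2 φ _ _ (suc n) _ L L-enum L′ L′-enum = begin
  totalWeight φ L                    ≡⟨ totalWeight-↭ φ (enumerations-↭ L-enum (fibres-enumerate L′-enum)) ⟩
  totalWeight φ (concatMap fibre L′) ≡⟨ totalWeight-concatMap φ (tilde φ) fibre (fibre-weight φ) L′ ⟩
  totalWeight (tilde φ) L′           ∎
  where open ≡-Reasoning
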